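{- Let $A$ be an srl-monoid and $a,b\in A$, and let $\theta(a,b)$ be the smallest congruence of $A$ containing $(a,b)$. Then for all $x,y\in A$, $(x,y)\in \theta(a,b)$ if and only if there exist $n,m\in\mathbb{N}$ such that $\square^{m}(s(a,b)^n)\leq s(x,y)$.
   Context: A commutative l-monoid is an algebra $(A,\wedge,\vee,\cdot,e)$ of type $(2,2,2,0)$ such that $(A,\wedge,\vee)$ is a lattice, $(A,\cdot,e)$ is a commutative monoid and $(a\vee b)\cdot c=(a\cdot c)\vee(b\cdot c)$ for all $a,b,c\in A$. An algebra $(A,\wedge,\vee,\cdot,\rightarrow,e)$ of type $(2,2,2,2,0)$ is an srl-monoid if $(A,\wedge,\vee,\cdot,e)$ is a commutative l-monoid and there is a subalgebra $Q$ of $(A,\wedge,\vee,\cdot,e)$ such that for all $a,b\in A$ the set $\{q\in Q: a\cdot q\leq b\}$ has a maximum and $a\rightarrow b$ equals this maximum. $s(a,b)=(a\rightarrow b)\wedge(b\rightarrow a)\wedge e$. $c^0=e$, $c^{n+1}=c\cdot c^n$. $\square(c)=e\rightarrow c$; $\square^0(c)=c$, $\square^1(c)=\square(c)$ and $\square^{k+1}(c)=\square(c)\cdot\square^k(c)$ for $k\ge1$. $\mathbb{N}=\{0,1,2,\dots\}$. -}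

module Defs where

open import Level using (Level; suc; _⊔_)
open import Data.Nat using (ℕ; zero) renaming (suc to 1+)
open import Data.Product using (Σ; _×_)
open import Relation.Binary.PropositionalEquality using (_≡_)
open import Relation.Binary.Structures using (IsEquivalence)
open import Algebra.Lattice.Structures using (IsLattice)
open import Algebra.Structures using (IsCommutativeMonoid)

record IsCommLMonoid {ℓ} {A : Set ℓ} (_∧_ _∨_ _·_ : A → A → A) (e : A) : Set ℓ where
  field
    isLattice           : IsLattice _≡_ _∨_ _∧_
    isCommutativeMonoid : IsCommutativeMonoid _≡_ _·_ e
    ·-distrib-∨         : ∀ a b c → ((a ∨ b) · c) ≡ ((a · c) ∨ (b · c))

module _ {ℓ} {A : Set ℓ} (_∧_ : A → A → A) where
  LatLeq : A → A → Set ℓ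
  LatLeq a b = (a ∧ b) ≡ a

record IsSubalgebra {ℓ} {A : Set ℓ} (_∧_ _∨_ _·_ : A → A → A) (e : A) (Q : A → Set ℓ) : Set ℓ where
  field
    ∧-closed : ∀ {a b} → Q a → Q b → Q (a ∧ b)
    ∨-closed : ∀ {a b} → Q a → Q b → Q (a ∨ b)
    ·-closed : ∀ {a b} → Q a → Q b → Q (a · b)
    e-closed : Q e

record SrlMonoid ℓ : Set (suc ℓ) where
  infixr 6 _∨_
  infixr 7 _∧_
  infixr 8 _·_
  infixr 5 _⇒_
  field
    Carrier : Set ℓ
    _∧_ _∨_ _·_ _⇒_ : Carrier → Carrier → Carrier
    e : Carrier
    isCommLMonoid : IsCommLMonoid _∧_ _∨_ _·_ e

  _≤_ : Carrier → Carrier → Set ℓ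
  _≤_ = LatLeq _∧_

  field
    -- the subalgebra Q witnessing that a ⇒ b = max {q ∈ Q : a · q ≤ b}
    Q             : Carrier → Set ℓ
    Q-subalgebra  : IsSubalgebra _∧_ _∨_ _·_ e Q
    ⇒-in-Q        : ∀ a b → Q (a ⇒ b)
    ⇒-satisfies   : ∀ a b → (a · (a ⇒ b)) ≤ b
    ⇒-maximum     : ∀ a b q → Q q → (a · q) ≤ b → q ≤ (a ⇒ b)

  s : Carrier → Carrier → Carrier
  s a b = (a ⇒ b) ∧ (b ⇒ a) ∧ e

  pow : Carrier → ℕ → Carrier
  pow c zero   = e
  pow c (1+ n) = c · pow c n

  □ : Carrier → Carrier
  □ c = e ⇒ c

  boxPow : ℕ → Carrier → Carrier
  boxPow zero c          = c
  boxPow (1+ zero) c     = □ c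
  boxPow (1+ (1+ k)) c   = □ c · boxPow (1+ k) c

  record IsCongruence (R : Carrier → Carrier → Set ℓ) : Set ℓ where
    field
      isEquivalence : IsEquivalence R
      ∧-cong : ∀ {a b c d} → R a b → R c d → R (a ∧ c) (b ∧ d)
      ∨-cong : ∀ {a b c d} → R a b → R c d → R (a ∨ c) (b ∨ d)
      ·-cong : ∀ {a b c d} → R a b → R c d → R (a · c) (b · d)
      ⇒-cong : ∀ {a b c d} → R a b → R c d → R (a ⇒ c) (b ⇒ d)

  θ : Carrier → Carrier → Carrier → Carrier → Set (suc ℓ)
  θ a b x y = (R : Carrier → Carrier → Set ℓ) → IsCongruence R → R a b → R x y

-- A congruence R relates x and y iff it relates s x y and e, and s is compatible with the
-- operations: s x y · s z w ≤ s (x ∘ z) (y ∘ w), and s x y · s y z ≤ s x z.  Hence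
-- "some power of s a b lies below s x y" is already a congruence containing (a, b).
-- Conversely a congruence relating a and b relates s a b, its powers and their boxes to e,
-- and with them every element between such a bound and e, in particular s x y.
module Submission where

open import Algebra.Bundles using (CommutativeMonoid)
open import Algebra.Core using (Op₂)
open import Algebra.Lattice.Bundles using (Lattice)
open import Algebra.Lattice.Structures using (IsLattice)
open import Algebra.Structures using (IsCommutativeMonoid)
open import Data.Nat using (ℕ; zero; _+_) renaming (suc to 1+)
open import Data.Product using (_,_; ∃-syntax; ∃₂; map₂)
open import Function.Bundles using (_⇔_; mk⇔)
open import Relation.Binary.Core using (Rel)
open import Relation.Binary.PropositionalEquality
  using (_≡_; sym; trans; cong; cong₂; subst; subst₂; module ≡-Reasoning)
  renaming (isEquivalence to ≡-isEquivalence)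
open import Relation.Binary.Structures using (IsEquivalence)
import Algebra.Lattice.Properties.Lattice as LatticeProperties
import Algebra.Properties.CommutativeSemigroup as CommutativeSemigroupProperties
import Relation.Binary.Lattice as Order
import Relation.Binary.Lattice.Properties.JoinSemilattice as JoinSemilatticeProperties
import Relation.Binary.Reasoning.PartialOrder as ≤-Reasoning

open import Defs

module LatticeOrder {a} {A : Set a} {_∧_ _∨_ : Op₂ A}
                    (isLattice : IsLattice _≡_ _∨_ _∧_) where

  infix 4 _≤_
  _≤_ : Rel A a
  _≤_ = LatLeq _∧_

  -- The library's natural order is x ≡ x ∧ y, the symmetric reading of _≤_.
  private
    lattice : Lattice a a
    lattice = record { isLattice = isLattice }

    module N = Order.Lattice (LatticeProperties.∨-∧-orderTheoreticLattice lattice)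

  orderLattice : Order.Lattice a a a
  orderLattice = record
    { isLattice = record
      { isPartialOrder = record
        { isPreorder = record
          { isEquivalence = ≡-isEquivalence
          ; reflexive     = λ x≡y → sym (N.reflexive x≡y)
          ; trans         = λ x≤y y≤z → sym (N.trans (sym x≤y) (sym y≤z))
          }
        ; antisym = λ x≤y y≤x → N.antisym (sym x≤y) (sym y≤x)
        }
      ; supremum = λ x y → sym (N.x≤x∨y x y) , sym (N.y≤x∨y x y)
                         , λ z x≤z y≤z → sym (N.∨-least (sym x≤z) (sym y≤z))
      ; infimum  = λ x y → sym (N.x∧y≤x x y) , sym (N.x∧y≤y x y)
                         , λ z z≤x z≤y → sym (N.∧-greatest (sym z≤x) (sym z≤y))
      }
    }

  open Order.Lattice orderLattice public
    using (x∧y≤x; x∧y≤y; ∧-greatest; x≤x∨y; y≤x∨y; ∨-least; poset)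
    renaming (refl to ≤-refl; reflexive to ≤-reflexive; trans to ≤-trans; antisym to ≤-antisym)
  open JoinSemilatticeProperties (Order.Lattice.joinSemilattice orderLattice) public
    using (x≤y⇒x∨y≈y)

module CommLMonoidOrder {a} {A : Set a} {_∧_ _∨_ _·_ : Op₂ A} {e : A}
                        (isCommLMonoid : IsCommLMonoid _∧_ _∨_ _·_ e) where

  open IsCommLMonoid isCommLMonoid
  open IsCommutativeMonoid isCommutativeMonoid using (comm; identityʳ)
  open LatticeOrder isLattice public

  ·-monoˡ-≤ : ∀ {x y} z → x ≤ y → x · z ≤ y · z
  ·-monoˡ-≤ {x} {y} z x≤y = subst (x · z ≤_) (begin
    (x · z) ∨ (y · z) ≡⟨ ·-distrib-∨ x y z ⟨
    (x ∨ y) · z       ≡⟨ cong (_· z) (x≤y⇒x∨y≈y x≤y) ⟩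
    y · z             ∎) (x≤x∨y (x · z) (y · z))
    where open ≡-Reasoning

  ·-monoʳ-≤ : ∀ z {x y} → x ≤ y → z · x ≤ z · y
  ·-monoʳ-≤ z {x} {y} x≤y = subst₂ _≤_ (comm x z) (comm y z) (·-monoˡ-≤ z x≤y)

  ·-mono-≤ : ∀ {x x′ y y′} → x ≤ x′ → y ≤ y′ → x · y ≤ x′ · y′
  ·-mono-≤ {x′ = x′} {y = y} x≤x′ y≤y′ = ≤-trans (·-monoˡ-≤ y x≤x′) (·-monoʳ-≤ x′ y≤y′)

  x·y≤x : ∀ x {y} → y ≤ e → x · y ≤ x
  x·y≤x x y≤e = subst (x · _ ≤_) (identityʳ x) (·-monoʳ-≤ x y≤e)

module SrlMonoidProperties {ℓ} (A : SrlMonoid ℓ) where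

  open SrlMonoid A hiding (_≤_)
  open IsCommLMonoid isCommLMonoid using (isLattice; isCommutativeMonoid; ·-distrib-∨)
  open IsLattice isLattice using (∨-comm)
  open IsCommutativeMonoid isCommutativeMonoid using (assoc; comm; identityˡ; identityʳ)
  open IsSubalgebra Q-subalgebra
  open CommLMonoidOrder isCommLMonoid

  private
    ·-commutativeMonoid : CommutativeMonoid ℓ ℓ
    ·-commutativeMonoid = record { isCommutativeMonoid = isCommutativeMonoid }

  open CommutativeSemigroupProperties (CommutativeMonoid.commutativeSemigroup ·-commutativeMonoid)
    using (interchange; x∙yz≈y∙xz)
  open ≤-Reasoning poset

  s∈Q : ∀ x y → Q (s x y)
  s∈Q x y = ∧-closed (⇒-in-Q x y) (∧-closed (⇒-in-Q y x) e-closed)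

  s≤⇒ : ∀ x y → s x y ≤ x ⇒ y
  s≤⇒ x y = x∧y≤x _ _

  s≤⇐ : ∀ x y → s x y ≤ y ⇒ x
  s≤⇐ x y = ≤-trans (x∧y≤y _ _) (x∧y≤x _ _)

  s≤e : ∀ x y → s x y ≤ e
  s≤e x y = ≤-trans (x∧y≤y _ _) (x∧y≤y _ _)

  s-greatest : ∀ {x y q} → Q q → x · q ≤ y → y · q ≤ x → q ≤ e → q ≤ s x y
  s-greatest {x} {y} {q} q∈Q xq≤y yq≤x q≤e =
    ∧-greatest (⇒-maximum x y q q∈Q xq≤y) (∧-greatest (⇒-maximum y x q q∈Q yq≤x) q≤e)

  x·q≤y : ∀ {x y q} → q ≤ s x y → x · q ≤ y
  x·q≤y {x} {y} q≤s = ≤-trans (·-monoʳ-≤ x (≤-trans q≤s (s≤⇒ x y))) (⇒-satisfies x y)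

  y·q≤x : ∀ {x y q} → q ≤ s x y → y · q ≤ x
  y·q≤x {x} {y} q≤s = ≤-trans (·-monoʳ-≤ y (≤-trans q≤s (s≤⇐ x y))) (⇒-satisfies y x)

  s-comm : ∀ x y → s x y ≡ s y x
  s-comm x y = ≤-antisym (s-swap x y) (s-swap y x)
    where
    s-swap : ∀ x y → s x y ≤ s y x
    s-swap x y = s-greatest (s∈Q x y) (y·q≤x ≤-refl) (x·q≤y ≤-refl) (s≤e x y)

  s-refl : ∀ x → s x x ≡ e
  s-refl x = ≤-antisym (s≤e x x) (s-greatest e-closed x·e≤x x·e≤x ≤-refl)
    where
    x·e≤x : x · e ≤ x
    x·e≤x = ≤-reflexive (identityʳ x)

  □e≡e : □ e ≡ e
  □e≡e = ≤-antisym (subst (_≤ e) (identityˡ (e ⇒ e)) (⇒-satisfies e e))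
                   (⇒-maximum e e e e-closed (≤-reflexive (identityʳ e)))

  s·s≤ˡ : ∀ x y z w → s x y · s z w ≤ s x y
  s·s≤ˡ x y z w = x·y≤x (s x y) (s≤e z w)

  s·s≤ʳ : ∀ x y z w → s x y · s z w ≤ s z w
  s·s≤ʳ x y z w = subst (_≤ s z w) (comm (s z w) (s x y)) (s·s≤ˡ z w x y)

  s·s≤e : ∀ x y z w → s x y · s z w ≤ e
  s·s≤e x y z w = ≤-trans (s·s≤ˡ x y z w) (s≤e x y)

  s·s∈Q : ∀ x y z w → Q (s x y · s z w)
  s·s∈Q x y z w = ·-closed (s∈Q x y) (s∈Q z w)

  s-trans : ∀ x y z → s x y · s y z ≤ s x z
  s-trans x y z = s-greatest (s·s∈Q x y y z) (chain x y z)
    (subst (λ q → z · q ≤ x) s·s-swap (chain z y x)) (s·s≤e x y y z)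
    where
    chain : ∀ x y z → x · (s x y · s y z) ≤ z
    chain x y z = begin
      x · (s x y · s y z) ≡⟨ assoc x (s x y) (s y z) ⟨
      (x · s x y) · s y z ≤⟨ ·-monoˡ-≤ (s y z) (x·q≤y ≤-refl) ⟩
      y · s y z           ≤⟨ x·q≤y ≤-refl ⟩
      z                   ∎
    s·s-swap : s z y · s y x ≡ s x y · s y z
    s·s-swap = trans (comm (s z y) (s y x)) (cong₂ _·_ (s-comm y x) (s-comm z y))

  Compatible : Op₂ Carrier → Set ℓ
  Compatible _∘_ = ∀ x y z w → (x ∘ z) · (s x y · s z w) ≤ y ∘ w

  s-compatible : ∀ {_∘_} → Compatible _∘_ →
                 ∀ x y z w → s x y · s z w ≤ s (x ∘ z) (y ∘ w)
  s-compatible {_∘_} compatible x y z w = s-greatest (s·s∈Q x y z w) (compatible x y z w)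
    (subst (λ q → (y ∘ w) · q ≤ x ∘ z) (cong₂ _·_ (s-comm y x) (s-comm w z)) (compatible y x w z))
    (s·s≤e x y z w)

  ∧-compatible : Compatible _∧_
  ∧-compatible x y z w = ∧-greatest
    (≤-trans (·-monoˡ-≤ _ (x∧y≤x x z)) (x·q≤y (s·s≤ˡ x y z w)))
    (≤-trans (·-monoˡ-≤ _ (x∧y≤y x z)) (x·q≤y (s·s≤ʳ x y z w)))

  ∨-compatible : Compatible _∨_
  ∨-compatible x y z w = subst (_≤ y ∨ w) (sym (·-distrib-∨ x z _)) (∨-least
    (≤-trans (x·q≤y (s·s≤ˡ x y z w)) (x≤x∨y y w))
    (≤-trans (x·q≤y (s·s≤ʳ x y z w)) (y≤x∨y y w)))

  ·-compatible : Compatible _·_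
  ·-compatible x y z w = subst (_≤ y · w) (sym (interchange x z (s x y) (s z w)))
    (·-mono-≤ (x·q≤y ≤-refl) (x·q≤y ≤-refl))

  ⇒-compatible : Compatible _⇒_
  ⇒-compatible x y z w =
    ⇒-maximum y w _ (·-closed (⇒-in-Q x z) (s·s∈Q x y z w)) (begin
      y · ((x ⇒ z) · (s x y · s z w)) ≡⟨ cong (y ·_) (x∙yz≈y∙xz (x ⇒ z) (s x y) (s z w)) ⟩
      y · (s x y · ((x ⇒ z) · s z w)) ≡⟨ assoc y (s x y) _ ⟨
      (y · s x y) · ((x ⇒ z) · s z w) ≤⟨ ·-monoˡ-≤ _ (y·q≤x ≤-refl) ⟩
      x · ((x ⇒ z) · s z w)           ≡⟨ assoc x (x ⇒ z) (s z w) ⟨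
      (x · (x ⇒ z)) · s z w           ≤⟨ ·-monoˡ-≤ (s z w) (⇒-satisfies x z) ⟩
      z · s z w                       ≤⟨ x·q≤y ≤-refl ⟩
      w                               ∎)

  pow-+ : ∀ c k l → pow c (k + l) ≡ pow c k · pow c l
  pow-+ c zero   l = sym (identityˡ (pow c l))
  pow-+ c (1+ k) l = trans (cong (c ·_) (pow-+ c k l)) (sym (assoc c (pow c k) (pow c l)))

  PowerBelow : Carrier → Rel Carrier ℓ
  PowerBelow c x y = ∃[ k ] pow c k ≤ s x y

  module _ (c : Carrier) where

    powerBelow-combine : ∀ {x y z w u v} → s x y · s z w ≤ s u v →
                         PowerBelow c x y → PowerBelow c z w → PowerBelow c u v
    powerBelow-combine ss≤s (k , cᵏ≤s) (l , cˡ≤s) =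
      k + l , subst (_≤ _) (sym (pow-+ c k l)) (≤-trans (·-mono-≤ cᵏ≤s cˡ≤s) ss≤s)

    powerBelow-cong : ∀ {_∘_} → Compatible _∘_ → ∀ {x y z w} →
                      PowerBelow c x y → PowerBelow c z w → PowerBelow c (x ∘ z) (y ∘ w)
    powerBelow-cong compatible {x} {y} {z} {w} =
      powerBelow-combine (s-compatible compatible x y z w)

    powerBelow-isCongruence : IsCongruence (PowerBelow c)
    powerBelow-isCongruence = record
      { isEquivalence = record
        { refl  = λ {x} → 0 , ≤-reflexive (sym (s-refl x))
        ; sym   = λ {x} {y} (k , cᵏ≤s) → k , subst (pow c k ≤_) (s-comm x y) cᵏ≤s
        ; trans = λ {x} {y} {z} → powerBelow-combine (s-trans x y z)
        }
      ; ∧-cong = powerBelow-cong ∧-compatible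
      ; ∨-cong = powerBelow-cong ∨-compatible
      ; ·-cong = powerBelow-cong ·-compatible
      ; ⇒-cong = powerBelow-cong ⇒-compatible
      }

  powerBelow-s : ∀ x y → PowerBelow (s x y) x y
  powerBelow-s x y = 1 , ≤-reflexive (identityʳ (s x y))

  module CongruenceProperties {R : Rel Carrier ℓ} (isCongruence : IsCongruence R) where

    open IsCongruence isCongruence
    open IsEquivalence isEquivalence renaming (refl to R-refl; sym to R-sym; trans to R-trans)

    s-related-e : ∀ {x y} → R x y → R (s x y) e
    s-related-e {x} {y} Rxy = subst (R (s x y)) (s-refl x)
      (∧-cong (⇒-cong R-refl (R-sym Rxy)) (∧-cong (⇒-cong (R-sym Rxy) R-refl) R-refl))

    pow-related-e : ∀ {c} → R c e → ∀ n → R (pow c n) e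
    pow-related-e Rce zero   = R-refl
    pow-related-e Rce (1+ n) = subst (R _) (identityˡ e) (·-cong Rce (pow-related-e Rce n))

    boxPow-related-e : ∀ {c} → R c e → ∀ m → R (boxPow m c) e
    boxPow-related-e Rce zero        = Rce
    boxPow-related-e Rce (1+ zero)   = subst (R _) □e≡e (⇒-cong R-refl Rce)
    boxPow-related-e Rce (1+ (1+ m)) =
      subst (R _) (identityˡ e) (·-cong (boxPow-related-e Rce 1) (boxPow-related-e Rce (1+ m)))

    -- (u · t) ∨ v = v is related to (u · e) ∨ v = u.
    sandwiched-related : ∀ {t u v} → R t e → u · t ≤ v → v ≤ u → R v u
    sandwiched-related {u = u} {v} Rte ut≤v v≤u = subst₂ R
      (x≤y⇒x∨y≈y ut≤v)
      (trans (cong (_∨ v) (identityʳ u)) (trans (∨-comm u v) (x≤y⇒x∨y≈y v≤u)))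
      (∨-cong (·-cong (R-refl {u}) Rte) (R-refl {v}))

    related-if-s-related-e : ∀ {x y} → R (s x y) e → R x y
    related-if-s-related-e {x} {y} Rse = R-trans
      (R-sym (sandwiched-related Rse (∧-greatest (x·y≤x x (s≤e x y)) (x·q≤y ≤-refl)) (x∧y≤x x y)))
      (sandwiched-related Rse (∧-greatest (y·q≤x ≤-refl) (x·y≤x y (s≤e x y))) (x∧y≤y x y))

    related-if-bounded : ∀ {a b x y} n m → R a b → boxPow m (pow (s a b) n) ≤ s x y → R x y
    related-if-bounded {x = x} {y} n m Rab d≤s = related-if-s-related-e
      (sandwiched-related (boxPow-related-e (pow-related-e (s-related-e Rab) n) m)
        (subst (_≤ s x y) (sym (identityˡ _)) d≤s) (s≤e x y))

theorem4p8 : ∀ {ℓ} (A : SrlMonoid ℓ) → let open SrlMonoid A in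
               ∀ (a b x y : Carrier) →
               θ a b x y ⇔ ∃₂ (λ (n m : ℕ) → boxPow m (pow (s a b) n) ≤ s x y)
theorem4p8 A a b x y = mk⇔
  (λ xθy → map₂ (0 ,_) (xθy (PowerBelow (s a b)) (powerBelow-isCongruence (s a b)) (powerBelow-s a b)))
  (λ (n , m , d≤s) R isCongruence Rab →
     CongruenceProperties.related-if-bounded isCongruence n m Rab d≤s)
  where
  open SrlMonoid A using (s)
  open SrlMonoidProperties A
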